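{- Let $p$ be a prime, $q=p^m$, and let $V=V_1\otimes V_2$, where $V_1,V_2$ are vector spaces over $\mathbb{F}_q$ of dimensions $t$ and $r$ respectively. Let $G_t\leq \mathrm{GL}(V_1)\cong\mathrm{GL}_t(q)$ and $G_r\leq\mathrm{GL}(V_2)\cong\mathrm{GL}_r(q)$, and let $G=G_t\circ G_r$ be the subgroup of $\mathrm{GL}(V)$ consisting of all maps $\sigma\otimes\tau$ with $\sigma\in G_t$, $\tau\in G_r$ (where $(\sigma\otimes\tau)(x\otimes y)=\sigma(x)\otimes\tau(y)$, extended linearly). Assume that $G$ acts (faithfully and) semisimply on $V$. If $H^1(G_t,V_1)=0$ and $H^1(G_r,V_2)=0$, then $H^1(G,V)=0$.
   Context: $H^1$ denotes first group cohomology. $G_t\circ G_r$ is a central product of $G_t$ and $G_r$, realized inside $\mathrm{GL}(V_1)\otimes\mathrm{GL}(V_2)\leq\mathrm{GL}(V)$. Acting semisimply means $V$ is a direct sum of irreducible $G$-modules. -}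

module Defs where

open import Level using (Level; _⊔_) renaming (suc to lsuc)
open import Data.Nat using (ℕ; _^_) renaming (_*_ to _*ℕ_; suc to sucℕ; zero to zeroℕ)
open import Data.Nat.Primality using (Prime)
open import Data.Fin using (Fin; zero; suc; remQuot)
open import Data.Product using (Σ; ∃; ∃-syntax; _×_; _,_; proj₁; proj₂)
open import Data.Sum using (_⊎_)
open import Relation.Nullary using (¬_)
open import Relation.Binary.PropositionalEquality using (_≡_)
open import Algebra.Bundles using (CommutativeRing)

record Field (c ℓ : Level) : Set (lsuc (c ⊔ ℓ)) where
  field
    commRing : CommutativeRing c ℓ
  open CommutativeRing commRing public
  field
    0≉1      : ¬ (0# ≈ 1#)
    inverse  : ∀ x → ¬ (x ≈ 0#) → ∃[ y ] (x * y ≈ 1#)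

HasOrder : ∀ {c ℓ} → Field c ℓ → ℕ → Set (c ⊔ ℓ)
HasOrder F n = Σ (Fin n → Carrier) λ f →
    (∀ x → ∃[ i ] (f i ≈ x)) × (∀ i j → f i ≈ f j → i ≡ j)
  where open Field F

IsFiniteFieldOfOrder : ∀ {c ℓ} → Field c ℓ → ℕ → ℕ → Set (c ⊔ ℓ)
IsFiniteFieldOfOrder F p m = Prime p × Σ ℕ (λ m' → m ≡ sucℕ m') × HasOrder F (p ^ m)

module LinAlg {c ℓ} (F : Field c ℓ) where
  open Field F public using (Carrier; _≈_; _+_; _*_; _-_; 0#; 1#)

  Vect : ℕ → Set c
  Vect n = Fin n → Carrier

  Mat : ℕ → Set c
  Mat n = Fin n → Fin n → Carrier

  sumF : ∀ {n} → (Fin n → Carrier) → Carrier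
  sumF {zeroℕ}  f = 0#
  sumF {sucℕ n} f = f zero + sumF (λ i → f (suc i))

  _≈ᵥ_ : ∀ {n} → Vect n → Vect n → Set ℓ
  u ≈ᵥ v = ∀ i → u i ≈ v i

  _≈ₘ_ : ∀ {n} → Mat n → Mat n → Set ℓ
  A ≈ₘ B = ∀ i j → A i j ≈ B i j

  0ᵥ : ∀ {n} → Vect n
  0ᵥ _ = 0#

  _+ᵥ_ : ∀ {n} → Vect n → Vect n → Vect n
  (u +ᵥ v) i = u i + v i

  _-ᵥ_ : ∀ {n} → Vect n → Vect n → Vect n
  (u -ᵥ v) i = u i - v i

  _·ᵥ_ : ∀ {n} → Carrier → Vect n → Vect n
  (a ·ᵥ v) i = a * v i

  sumV : ∀ {n k} → (Fin k → Vect n) → Vect n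
  sumV vs j = sumF (λ i → vs i j)

  _⊙_ : ∀ {n} → Mat n → Vect n → Vect n
  (A ⊙ v) i = sumF (λ j → A i j * v j)

  _⊗ₘ_ : ∀ {n} → Mat n → Mat n → Mat n
  (A ⊗ₘ B) i j = sumF (λ k → A i k * B k j)

  idM : ∀ {n} → Mat n
  idM {sucℕ n} zero    zero    = 1#
  idM {sucℕ n} zero    (suc j) = 0#
  idM {sucℕ n} (suc i) zero    = 0#
  idM {sucℕ n} (suc i) (suc j) = idM i j

  Invertible : ∀ {n} → Mat n → Set (c ⊔ ℓ)
  Invertible A = ∃[ B ] ((A ⊗ₘ B) ≈ₘ idM × (B ⊗ₘ A) ≈ₘ idM)

  -- Tensor (Kronecker) product σ ⊗ τ of σ ∈ GL_t and τ ∈ GL_r, acting on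
  -- F^t ⊗ F^r ≅ F^(t*r) with basis e_i ⊗ f_j ↦ index combine i j:
  -- (σ ⊗ τ)(x ⊗ y) = σ x ⊗ τ y.
  kron : ∀ {t r} → Mat t → Mat r → Mat (t *ℕ r)
  kron {t} {r} σ τ a b with remQuot {t} r a | remQuot {t} r b
  ... | (i , j) | (k , l) = σ i k * τ j l

  record IsSubgroupGL {n} (P : Mat n → Set (c ⊔ ℓ)) : Set (c ⊔ ℓ) where
    field
      resp    : ∀ {A B} → A ≈ₘ B → P A → P B
      invble  : ∀ {A} → P A → Invertible A
      has-id  : P idM
      mul     : ∀ {A B} → P A → P B → P (A ⊗ₘ B)
      inv     : ∀ {A B} → P A → (A ⊗ₘ B) ≈ₘ idM → P B

  CentralProduct : ∀ {t r} → (Mat t → Set (c ⊔ ℓ)) → (Mat r → Set (c ⊔ ℓ))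
                 → Mat (t *ℕ r) → Set (c ⊔ ℓ)
  CentralProduct Gt Gr M = ∃[ σ ] ∃[ τ ] (Gt σ × Gr τ × M ≈ₘ kron σ τ)

  Elt : ∀ {n} → (Mat n → Set (c ⊔ ℓ)) → Set (c ⊔ ℓ)
  Elt {n} G = Σ (Mat n) G

  record IsCocycle {n} (G : Mat n → Set (c ⊔ ℓ)) (δ : Elt G → Vect n) : Set (c ⊔ ℓ) where
    field
      δ-resp : ∀ (g h : Elt G) → proj₁ g ≈ₘ proj₁ h → δ g ≈ᵥ δ h
      δ-mul  : ∀ (g h : Elt G) (gh : G (proj₁ g ⊗ₘ proj₁ h)) →
               δ (proj₁ g ⊗ₘ proj₁ h , gh) ≈ᵥ (δ g +ᵥ (proj₁ g ⊙ δ h))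

  IsCoboundary : ∀ {n} (G : Mat n → Set (c ⊔ ℓ)) (δ : Elt G → Vect n) → Set (c ⊔ ℓ)
  IsCoboundary {n} G δ = ∃[ v ] (∀ (g : Elt G) → δ g ≈ᵥ ((proj₁ g ⊙ v) -ᵥ v))

  H¹-vanishes : ∀ {n} → (Mat n → Set (c ⊔ ℓ)) → Set (c ⊔ ℓ)
  H¹-vanishes G = ∀ δ → IsCocycle G δ → IsCoboundary G δ

  record IsSubspace {n} (W : Vect n → Set (c ⊔ ℓ)) : Set (c ⊔ ℓ) where
    field
      resp  : ∀ {u v} → u ≈ᵥ v → W u → W v
      zero∈ : W 0ᵥ
      add   : ∀ {u v} → W u → W v → W (u +ᵥ v)
      scale : ∀ a {v} → W v → W (a ·ᵥ v)

  record IsGSubmodule {n} (G : Mat n → Set (c ⊔ ℓ)) (W : Vect n → Set (c ⊔ ℓ)) : Set (c ⊔ ℓ) where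
    field
      subspace  : IsSubspace W
      invariant : ∀ {g v} → G g → W v → W (g ⊙ v)

  record IsIrreducible {n} (G : Mat n → Set (c ⊔ ℓ)) (W : Vect n → Set (c ⊔ ℓ)) : Set (lsuc (c ⊔ ℓ)) where
    field
      submodule : IsGSubmodule G W
      nonzero   : ∃[ v ] (W v × ¬ (v ≈ᵥ 0ᵥ))
      minimal   : ∀ (U : Vect n → Set (c ⊔ ℓ)) → IsGSubmodule G U →
                  (∀ {v} → U v → W v) →
                  (∀ {v} → U v → v ≈ᵥ 0ᵥ) ⊎ (∀ {v} → W v → U v)

  -- G acts semisimply on F^n: F^n is a (internal) direct sum of
  -- irreducible G-submodules W_0, …, W_{k-1}.
  Semisimple : ∀ {n} → (Mat n → Set (c ⊔ ℓ)) → Set (lsuc (c ⊔ ℓ))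
  Semisimple {n} G = ∃[ k ] Σ (Fin k → Vect n → Set (c ⊔ ℓ)) λ W →
      (∀ i → IsIrreducible G (W i))
    × (∀ v → ∃[ w ] ((∀ i → W i (w i)) × v ≈ᵥ sumV w))
    × (∀ (w : Fin k → Vect n) → (∀ i → W i (w i)) → sumV w ≈ᵥ 0ᵥ → ∀ i → w i ≈ᵥ 0ᵥ)

module Submission where

-- Let δ be a 1-cocycle of G.  As a G_t-module, F^t ⊗ F^r is r
-- copies of F^t (the columns), so H¹(G_t, F^t) = 0 makes δ a coboundary ∂v
-- on G_t ⊗ 1; replacing δ by δ - ∂v, δ vanishes on G_t ⊗ 1.  As σ ⊗ 1 and
-- 1 ⊗ τ commute, δ(σ ⊗ τ) = δ(1 ⊗ τ), a vector fixed by G_t ⊗ 1.  By the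
-- same argument on rows, δ = ∂w on 1 ⊗ G_r.  Since G_t ⊗ 1 is normal and G
-- is semisimple, there is a G-equivariant linear projection Pr onto the
-- G_t ⊗ 1-fixed vectors, and δ = ∂(Pr w) on all of G.

open import Defs
open import Level using (_⊔_)
open import Data.Nat using (ℕ) renaming (_*_ to _*ℕ_; _+_ to _+ℕ_; suc to sucℕ; zero to zeroℕ)
open import Data.Fin using (Fin; zero; suc; remQuot; combine; _↑ˡ_; _↑ʳ_)
open import Data.Fin.Properties using (remQuot-combine; combine-remQuot)
open import Data.Product using (∃-syntax; _×_; _,_; proj₁; proj₂; uncurry)
import Data.Product as Product
open import Data.Sum using (_⊎_; inj₁; inj₂)
import Relation.Binary.PropositionalEquality as P
open P using (_≡_)

module Tensor {c ℓ} (F : Field c ℓ) where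
  open Field F hiding (zero)
  open LinAlg F hiding (Carrier; _≈_; _+_; _*_; _-_; 0#; 1#)
  open import Relation.Binary.Reasoning.Setoid setoid
  open import Algebra.Properties.Ring ring using (-1*x≈-x; x[y-z]≈xy-xz)
  open import Algebra.Properties.AbelianGroup +-abelianGroup using (⁻¹-∙-comm)
  open import Algebra.Properties.Group +-group using (//-rightDividesˡ; x∙y⁻¹≈ε⇒x≈y; x≈y⇒x∙y⁻¹≈ε)
  open import Algebra.Properties.CommutativeSemigroup +-commutativeSemigroup
    using () renaming (interchange to +-interchange)
  open import Algebra.Properties.CommutativeSemigroup *-commutativeSemigroup
    using () renaming (interchange to *-interchange)
  open import Algebra.Properties.Semiring.Sum semiring
    using (sum; sum-cong-≋; sum-cong-≗; sum-replicate-zero; ∑-distrib-+; ∑-comm; *-distribˡ-sum; *-distribʳ-sum)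
  open import Data.Vec.Functional.Relation.Binary.Equality.Setoid setoid
    using () renaming (≋-refl to ≈ᵥ-refl; ≋-sym to ≈ᵥ-sym; ≋-trans to ≈ᵥ-trans)

  sub-+ : ∀ a b a' b' → (a + b) - (a' + b') ≈ (a - a') + (b - b')
  sub-+ a b a' b' = trans (+-congˡ (sym (⁻¹-∙-comm a' b'))) (+-interchange a b (- a') (- b'))

  telescope : ∀ a b d → (b - d) + (a - b) ≈ a - d
  telescope a b d = begin
    (b - d) + (a - b)   ≈⟨ +-comm (b - d) (a - b) ⟩
    (a - b) + (b - d)   ≈⟨ +-assoc a (- b) (b - d) ⟩
    a + (- b + (b - d)) ≈⟨ +-congˡ (sym (+-assoc (- b) b (- d))) ⟩
    a + ((- b + b) - d) ≈⟨ +-congˡ (+-congʳ (-‿inverseˡ b)) ⟩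
    a + (0# - d)        ≈⟨ +-congˡ (+-identityˡ (- d)) ⟩
    a - d               ∎

  sub-cong : ∀ {a a' b b'} → a ≈ a' → b ≈ b' → a - b ≈ a' - b'
  sub-cong e f = +-cong e (-‿cong f)

  -- Finite sums.  sumF is the library's `sum`, so its algebra is inherited.

  sumF≡sum : ∀ {n} (f : Fin n → Carrier) → sumF f ≡ sum f
  sumF≡sum {zeroℕ}  f = P.refl
  sumF≡sum {sucℕ n} f = P.cong (f zero +_) (sumF≡sum (λ i → f (suc i)))

  ≈-up-to-≡ : ∀ {x x' y y'} → x ≡ x' → x' ≈ y' → y ≡ y' → x ≈ y
  ≈-up-to-≡ P.refl e P.refl = e

  sumF-cong : ∀ {n} {f g : Fin n → Carrier} → (∀ i → f i ≈ g i) → sumF f ≈ sumF g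
  sumF-cong {f = f} {g} e = ≈-up-to-≡ (sumF≡sum f) (sum-cong-≋ e) (sumF≡sum g)

  sumF-zero : ∀ {n} (f : Fin n → Carrier) → (∀ i → f i ≈ 0#) → sumF f ≈ 0#
  sumF-zero {n} f e = trans (sumF-cong e) (≈-up-to-≡ (sumF≡sum {n} (λ _ → 0#)) (sum-replicate-zero n) P.refl)

  sumF-+ : ∀ {n} (f g : Fin n → Carrier) → sumF (λ i → f i + g i) ≈ sumF f + sumF g
  sumF-+ f g = ≈-up-to-≡ (sumF≡sum (λ i → f i + g i)) (∑-distrib-+ f g) (P.cong₂ _+_ (sumF≡sum f) (sumF≡sum g))

  sumF-*ˡ : ∀ {n} a (f : Fin n → Carrier) → a * sumF f ≈ sumF (λ i → a * f i)
  sumF-*ˡ a f = ≈-up-to-≡ (P.cong (a *_) (sumF≡sum f)) (*-distribˡ-sum a f) (sumF≡sum (λ i → a * f i))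

  sumF-*ʳ : ∀ {n} a (f : Fin n → Carrier) → sumF f * a ≈ sumF (λ i → f i * a)
  sumF-*ʳ a f = ≈-up-to-≡ (P.cong (_* a) (sumF≡sum f)) (*-distribʳ-sum a f) (sumF≡sum (λ i → f i * a))

  sumF-swap : ∀ {m n} (f : Fin m → Fin n → Carrier) →
              sumF (λ i → sumF (λ j → f i j)) ≈ sumF (λ j → sumF (λ i → f i j))
  sumF-swap f = ≈-up-to-≡ (double f) (∑-comm f) (double (λ j i → f i j))
    where
    double : ∀ {m n} (g : Fin m → Fin n → Carrier) →
             sumF (λ i → sumF (g i)) ≡ sum (λ i → sum (g i))
    double g = P.trans (sumF≡sum (λ i → sumF (g i))) (sum-cong-≗ (λ i → sumF≡sum (g i)))

  sumF-neg : ∀ {n} (f : Fin n → Carrier) → sumF (λ i → - f i) ≈ - sumF f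
  sumF-neg f = begin
    sumF (λ i → - f i)      ≈⟨ sumF-cong (λ i → sym (-1*x≈-x (f i))) ⟩
    sumF (λ i → - 1# * f i) ≈⟨ sumF-*ˡ (- 1#) f ⟨
    - 1# * sumF f           ≈⟨ -1*x≈-x (sumF f) ⟩
    - sumF f                ∎

  sumF-- : ∀ {n} (f g : Fin n → Carrier) → sumF (λ i → f i - g i) ≈ sumF f - sumF g
  sumF-- f g = trans (sumF-+ f (λ i → - g i)) (+-congˡ (sumF-neg g))

  sumF-idM : ∀ {n} (j : Fin n) (x : Fin n → Carrier) → sumF (λ l → idM j l * x l) ≈ x j
  sumF-idM zero    x = begin
    1# * x zero + sumF (λ l → 0# * x (suc l))
      ≈⟨ +-cong (*-identityˡ (x zero)) (sumF-zero _ (λ l → zeroˡ (x (suc l)))) ⟩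
    x zero + 0# ≈⟨ +-identityʳ (x zero) ⟩
    x zero      ∎
  sumF-idM (suc j) x = trans (+-cong (zeroˡ (x zero)) (sumF-idM j (λ l → x (suc l)))) (+-identityˡ _)

  idM-sym : ∀ {n} (i j : Fin n) → idM i j ≡ idM j i
  idM-sym zero    zero    = P.refl
  idM-sym zero    (suc j) = P.refl
  idM-sym (suc i) zero    = P.refl
  idM-sym (suc i) (suc j) = idM-sym i j

  sumF-idMʳ : ∀ {n} (j : Fin n) (x : Fin n → Carrier) → sumF (λ l → x l * idM l j) ≈ x j
  sumF-idMʳ j x = trans (sumF-cong (λ l → trans (*-comm (x l) _) (*-congʳ (reflexive (idM-sym l j)))))
                        (sumF-idM j x)

  sumF-split : ∀ m {n} (f : Fin (m +ℕ n) → Carrier) →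
               sumF f ≈ sumF (λ i → f (i ↑ˡ n)) + sumF (λ j → f (m ↑ʳ j))
  sumF-split zeroℕ    f = sym (+-identityˡ _)
  sumF-split (sucℕ m) f = trans (+-congˡ (sumF-split m (λ i → f (suc i)))) (sym (+-assoc (f zero) _ _))

  sumF-combine : ∀ {t r} (f : Fin (t *ℕ r) → Carrier) →
                 sumF f ≈ sumF {t} (λ i → sumF {r} (λ j → f (combine i j)))
  sumF-combine {zeroℕ}      f = refl
  sumF-combine {sucℕ t} {r} f = trans (sumF-split r f) (+-congˡ (sumF-combine {t} (λ a → f (r ↑ʳ a))))

  ≈ₘ-refl : ∀ {n} {A : Mat n} → A ≈ₘ A
  ≈ₘ-refl i j = refl

  ≈ₘ-sym : ∀ {n} {A B : Mat n} → A ≈ₘ B → B ≈ₘ A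
  ≈ₘ-sym e i j = sym (e i j)

  ≈ₘ-trans : ∀ {n} {A B C : Mat n} → A ≈ₘ B → B ≈ₘ C → A ≈ₘ C
  ≈ₘ-trans e f i j = trans (e i j) (f i j)

  ⊙-cong : ∀ {n} {A A' : Mat n} {u u' : Vect n} → A ≈ₘ A' → u ≈ᵥ u' → (A ⊙ u) ≈ᵥ (A' ⊙ u')
  ⊙-cong eA eu i = sumF-cong (λ j → *-cong (eA i j) (eu j))

  ⊙-+ : ∀ {n} (A : Mat n) (u v : Vect n) → (A ⊙ (u +ᵥ v)) ≈ᵥ ((A ⊙ u) +ᵥ (A ⊙ v))
  ⊙-+ A u v i = trans (sumF-cong (λ j → distribˡ (A i j) (u j) (v j)))
                      (sumF-+ (λ j → A i j * u j) (λ j → A i j * v j))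

  ⊙-- : ∀ {n} (A : Mat n) (u v : Vect n) → (A ⊙ (u -ᵥ v)) ≈ᵥ ((A ⊙ u) -ᵥ (A ⊙ v))
  ⊙-- A u v i = trans (sumF-cong (λ j → x[y-z]≈xy-xz (A i j) (u j) (v j)))
                      (sumF-- (λ j → A i j * u j) (λ j → A i j * v j))

  ⊙-0 : ∀ {n} (A : Mat n) → (A ⊙ 0ᵥ) ≈ᵥ 0ᵥ
  ⊙-0 A i = sumF-zero (λ j → A i j * 0#) (λ j → zeroʳ (A i j))

  ⊙-scale : ∀ {n} (A : Mat n) a (v : Vect n) → (A ⊙ (a ·ᵥ v)) ≈ᵥ (a ·ᵥ (A ⊙ v))
  ⊙-scale A a v i = trans (sumF-cong (λ j → x*[a*y]≈a*[x*y] (A i j) (v j)))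
                          (sym (sumF-*ˡ a (λ j → A i j * v j)))
    where
    x*[a*y]≈a*[x*y] : ∀ x y → x * (a * y) ≈ a * (x * y)
    x*[a*y]≈a*[x*y] x y = trans (sym (*-assoc x a y)) (trans (*-congʳ (*-comm x a)) (*-assoc a x y))

  ⊙-sumV : ∀ {n k} (A : Mat n) (ws : Fin k → Vect n) → (A ⊙ sumV ws) ≈ᵥ sumV (λ m → A ⊙ ws m)
  ⊙-sumV A ws i = trans (sumF-cong (λ j → sumF-*ˡ (A i j) (λ m → ws m j)))
                        (sumF-swap (λ j m → A i j * ws m j))

  ⊙-assoc : ∀ {n} (A B : Mat n) (v : Vect n) → ((A ⊗ₘ B) ⊙ v) ≈ᵥ (A ⊙ (B ⊙ v))
  ⊙-assoc A B v i = begin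
    sumF (λ j → sumF (λ k → A i k * B k j) * v j)
      ≈⟨ sumF-cong (λ j → trans (sumF-*ʳ (v j) (λ k → A i k * B k j))
                                (sumF-cong (λ k → *-assoc (A i k) (B k j) (v j)))) ⟩
    sumF (λ j → sumF (λ k → A i k * (B k j * v j)))
      ≈⟨ sumF-swap (λ j k → A i k * (B k j * v j)) ⟩
    sumF (λ k → sumF (λ j → A i k * (B k j * v j)))
      ≈⟨ sumF-cong (λ k → sumF-*ˡ (A i k) (λ j → B k j * v j)) ⟨
    sumF (λ k → A i k * sumF (λ j → B k j * v j)) ∎

  ⊗ₘ-assoc : ∀ {n} (A B C : Mat n) → ((A ⊗ₘ B) ⊗ₘ C) ≈ₘ (A ⊗ₘ (B ⊗ₘ C))
  ⊗ₘ-assoc A B C i j = ⊙-assoc A B (λ k → C k j) i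

  ⊗ₘ-cong : ∀ {n} {A A' B B' : Mat n} → A ≈ₘ A' → B ≈ₘ B' → (A ⊗ₘ B) ≈ₘ (A' ⊗ₘ B')
  ⊗ₘ-cong eA eB i j = sumF-cong (λ k → *-cong (eA i k) (eB k j))

  idM-⊗ₘ : ∀ {n} (A : Mat n) → (idM ⊗ₘ A) ≈ₘ A
  idM-⊗ₘ A i j = sumF-idM i (λ k → A k j)

  ⊗ₘ-idM : ∀ {n} (A : Mat n) → (A ⊗ₘ idM) ≈ₘ A
  ⊗ₘ-idM A i j = sumF-idMʳ j (λ k → A i k)

  sumV-cong : ∀ {n k} {ws ws' : Fin k → Vect n} → (∀ m → ws m ≈ᵥ ws' m) → sumV ws ≈ᵥ sumV ws'
  sumV-cong e j = sumF-cong (λ m → e m j)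

  agree-on-cover : ∀ {A B : Set} {N} (pos : A → B → Fin N) (unpos : Fin N → A × B) →
                   (∀ a → uncurry pos (unpos a) ≡ a) →
                   ∀ {u v : Vect N} → (∀ i j → u (pos i j) ≈ v (pos i j)) → u ≈ᵥ v
  agree-on-cover pos unpos cover {u} {v} e a = P.subst (λ b → u b ≈ v b) (cover a) (uncurry e (unpos a))

  module Kronecker (t r : ℕ) where

    ext : ∀ {u v : Vect (t *ℕ r)} → (∀ i j → u (combine i j) ≈ v (combine i j)) → u ≈ᵥ v
    ext = agree-on-cover (combine {t} {r}) (remQuot {t} r) (combine-remQuot {t} r)

    extₘ : ∀ {A B : Mat (t *ℕ r)} →
           (∀ i j k l → A (combine i j) (combine k l) ≈ B (combine i j) (combine k l)) → A ≈ₘ B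
    extₘ {A} {B} e a b = ext {λ a' → A a' b} {λ a' → B a' b}
                             (λ i j → ext {A (combine i j)} {B (combine i j)} (e i j) b) a

    kron-combine : (σ : Mat t) (τ : Mat r) (i k : Fin t) (j l : Fin r) →
                   kron σ τ (combine i j) (combine k l) ≡ σ i k * τ j l
    kron-combine σ τ i k j l =
      P.cong₂ _*_ (P.cong₂ σ (P.cong proj₁ ij) (P.cong proj₁ kl)) (P.cong₂ τ (P.cong proj₂ ij) (P.cong proj₂ kl))
      where
      ij = remQuot-combine {t} {r} i j
      kl = remQuot-combine {t} {r} k l

    _⊗1 : Mat t → Mat (t *ℕ r)
    σ ⊗1 = kron σ idM

    1⊗_ : Mat r → Mat (t *ℕ r)
    1⊗ τ = kron {t} idM τ

    kron-cong : ∀ {σ σ' : Mat t} {τ τ' : Mat r} → σ ≈ₘ σ' → τ ≈ₘ τ' → kron σ τ ≈ₘ kron σ' τ'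
    kron-cong {σ} {σ'} {τ} {τ'} e f = extₘ λ i j k l →
      ≈-up-to-≡ (kron-combine σ τ i k j l) (*-cong (e i k) (f j l)) (kron-combine σ' τ' i k j l)

    kron-act : (σ : Mat t) (τ : Mat r) (x : Vect (t *ℕ r)) (i : Fin t) (j : Fin r) →
      (kron σ τ ⊙ x) (combine i j) ≈ sumF (λ k → sumF (λ l → (σ i k * τ j l) * x (combine k l)))
    kron-act σ τ x i j = trans (sumF-combine {t} {r} (λ b → kron σ τ (combine i j) b * x b))
      (sumF-cong λ k → sumF-cong λ l → *-congʳ (reflexive (kron-combine σ τ i k j l)))

    kron-mul : (σ σ' : Mat t) (τ τ' : Mat r) → (kron σ τ ⊗ₘ kron σ' τ') ≈ₘ kron (σ ⊗ₘ σ') (τ ⊗ₘ τ')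
    kron-mul σ σ' τ τ' = extₘ λ i j k l → begin
      (kron σ τ ⊗ₘ kron σ' τ') (combine i j) (combine k l)
        ≈⟨ sumF-combine {t} {r} (λ b → kron σ τ (combine i j) b * kron σ' τ' b (combine k l)) ⟩
      sumF {t} (λ m → sumF {r} (λ n → kron σ τ (combine i j) (combine m n) * kron σ' τ' (combine m n) (combine k l)))
        ≈⟨ sumF-cong (λ m → sumF-cong (λ n →
             reflexive (P.cong₂ _*_ (kron-combine σ τ i m j n) (kron-combine σ' τ' m k n l)))) ⟩
      sumF (λ m → sumF (λ n → (σ i m * τ j n) * (σ' m k * τ' n l)))
        ≈⟨ sumF-cong (λ m → sumF-cong (λ n → *-interchange (σ i m) (τ j n) (σ' m k) (τ' n l))) ⟩
      sumF (λ m → sumF (λ n → (σ i m * σ' m k) * (τ j n * τ' n l)))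
        ≈⟨ sumF-cong (λ m → sumF-*ˡ (σ i m * σ' m k) (λ n → τ j n * τ' n l)) ⟨
      sumF (λ m → (σ i m * σ' m k) * sumF (λ n → τ j n * τ' n l))
        ≈⟨ sumF-*ʳ (sumF (λ n → τ j n * τ' n l)) (λ m → σ i m * σ' m k) ⟨
      (σ ⊗ₘ σ') i k * (τ ⊗ₘ τ') j l
        ≡⟨ kron-combine (σ ⊗ₘ σ') (τ ⊗ₘ τ') i k j l ⟨
      kron (σ ⊗ₘ σ') (τ ⊗ₘ τ') (combine i j) (combine k l) ∎

    kron-left-act : (σ : Mat t) (x : Vect (t *ℕ r)) (i : Fin t) (j : Fin r) →
      ((σ ⊗1) ⊙ x) (combine i j) ≈ (σ ⊙ (λ k → x (combine k j))) i
    kron-left-act σ x i j = trans (kron-act σ idM x i j) (sumF-cong λ k → begin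
      sumF (λ l → (σ i k * idM j l) * x (combine k l))
        ≈⟨ sumF-cong (λ l → trans (*-congʳ (*-comm (σ i k) (idM j l))) (*-assoc (idM j l) (σ i k) _)) ⟩
      sumF (λ l → idM j l * (σ i k * x (combine k l)))
        ≈⟨ sumF-idM j (λ l → σ i k * x (combine k l)) ⟩
      σ i k * x (combine k j) ∎)

    kron-right-act : (τ : Mat r) (x : Vect (t *ℕ r)) (i : Fin t) (j : Fin r) →
      ((1⊗ τ) ⊙ x) (combine i j) ≈ (τ ⊙ (λ l → x (combine i l))) j
    kron-right-act τ x i j = trans (kron-act idM τ x i j) (begin
      sumF {t} (λ k → sumF {r} (λ l → (idM i k * τ j l) * x (combine k l)))
        ≈⟨ sumF-swap (λ k l → (idM i k * τ j l) * x (combine k l)) ⟩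
      sumF (λ l → sumF (λ k → (idM i k * τ j l) * x (combine k l)))
        ≈⟨ sumF-cong (λ l → trans (sumF-cong (λ k → *-assoc (idM i k) (τ j l) _))
                                  (sumF-idM i (λ k → τ j l * x (combine k l)))) ⟩
      sumF (λ l → τ j l * x (combine i l)) ∎)

    kron-factorˡ : ∀ σ τ → ((σ ⊗1) ⊗ₘ (1⊗ τ)) ≈ₘ kron σ τ
    kron-factorˡ σ τ = ≈ₘ-trans (kron-mul σ idM idM τ) (kron-cong (⊗ₘ-idM σ) (idM-⊗ₘ τ))

    kron-factorʳ : ∀ σ τ → ((1⊗ τ) ⊗ₘ (σ ⊗1)) ≈ₘ kron σ τ
    kron-factorʳ σ τ = ≈ₘ-trans (kron-mul idM σ τ idM) (kron-cong (idM-⊗ₘ σ) (⊗ₘ-idM τ))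

  ∂ : ∀ {n} → Vect n → Mat n → Vect n
  ∂ v g = (g ⊙ v) -ᵥ v

  ∂-cong : ∀ {n} (v : Vect n) {g h : Mat n} → g ≈ₘ h → ∂ v g ≈ᵥ ∂ v h
  ∂-cong v e i = sub-cong (⊙-cong e ≈ᵥ-refl i) refl

  ∂-+ : ∀ {n} (u v : Vect n) (g : Mat n) → ∂ (u +ᵥ v) g ≈ᵥ (∂ u g +ᵥ ∂ v g)
  ∂-+ u v g i = trans (sub-cong (⊙-+ g u v i) refl) (sub-+ _ _ (u i) (v i))

  module _ {n} (G : Mat n → Set (c ⊔ ℓ)) where

    ∂-isCocycle : (v : Vect n) → IsCocycle G (λ g → ∂ v (proj₁ g))
    ∂-isCocycle v = record
      { δ-resp = λ _ _ → ∂-cong v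
      ; δ-mul  = λ { (g , _) (h , _) _ i → begin
          ((g ⊗ₘ h) ⊙ v) i - v i                            ≈⟨ sub-cong (⊙-assoc g h v i) refl ⟩
          (g ⊙ (h ⊙ v)) i - v i                             ≈⟨ telescope _ ((g ⊙ v) i) (v i) ⟨
          ((g ⊙ v) i - v i) + ((g ⊙ (h ⊙ v)) i - (g ⊙ v) i) ≈⟨ +-congˡ (⊙-- g (h ⊙ v) v i) ⟨
          ((g ⊙ v) i - v i) + (g ⊙ ∂ v h) i                  ∎ }
      }

    cocycle-sub : ∀ {δ ε : Elt G → Vect n} → IsCocycle G δ → IsCocycle G ε →
                  IsCocycle G (λ g → δ g -ᵥ ε g)
    cocycle-sub {δ} {ε} cδ cε = record
      { δ-resp = λ g h e i → sub-cong (Cδ.δ-resp g h e i) (Cε.δ-resp g h e i)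
      ; δ-mul  = λ g h gh i → let A = proj₁ g in begin
          δ (A ⊗ₘ proj₁ h , gh) i - ε (A ⊗ₘ proj₁ h , gh) i
            ≈⟨ sub-cong (Cδ.δ-mul g h gh i) (Cε.δ-mul g h gh i) ⟩
          (δ g i + (A ⊙ δ h) i) - (ε g i + (A ⊙ ε h) i)
            ≈⟨ sub-+ (δ g i) _ (ε g i) _ ⟩
          (δ g i - ε g i) + ((A ⊙ δ h) i - (A ⊙ ε h) i)
            ≈⟨ +-congˡ (⊙-- A (δ h) (ε h) i) ⟨
          (δ g i - ε g i) + (A ⊙ (λ j → δ h j - ε h j)) i ∎
      }
      where
      module Cδ = IsCocycle cδ
      module Cε = IsCocycle cε

    vanishing-commuting : ∀ {δ} → IsCocycle G δ → (a b : Elt G) → δ a ≈ᵥ 0ᵥ →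
      (ab : G (proj₁ a ⊗ₘ proj₁ b)) → G (proj₁ b ⊗ₘ proj₁ a) →
      (proj₁ a ⊗ₘ proj₁ b) ≈ₘ (proj₁ b ⊗ₘ proj₁ a) →
      δ (proj₁ a ⊗ₘ proj₁ b , ab) ≈ᵥ δ b × (proj₁ a ⊙ δ b) ≈ᵥ δ b
    vanishing-commuting {δ} cδ a@(A , _) b@(B , _) δa≈0 ab ba comm = δab≈δb , aδb≈δb
      where
      open IsCocycle cδ
      δab≈δb : δ (A ⊗ₘ B , ab) ≈ᵥ δ b
      δab≈δb i = begin
        δ (A ⊗ₘ B , ab) i      ≈⟨ δ-resp (A ⊗ₘ B , ab) (B ⊗ₘ A , ba) comm i ⟩
        δ (B ⊗ₘ A , ba) i      ≈⟨ δ-mul b a ba i ⟩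
        δ b i + (B ⊙ δ a) i    ≈⟨ +-congˡ (trans (⊙-cong {A = B} ≈ₘ-refl δa≈0 i) (⊙-0 B i)) ⟩
        δ b i + 0#             ≈⟨ +-identityʳ (δ b i) ⟩
        δ b i                  ∎
      aδb≈δb : (A ⊙ δ b) ≈ᵥ δ b
      aδb≈δb i = begin
        (A ⊙ δ b) i            ≈⟨ +-identityˡ _ ⟨
        0# + (A ⊙ δ b) i       ≈⟨ +-congʳ (δa≈0 i) ⟨
        δ a i + (A ⊙ δ b) i    ≈⟨ δ-mul a b ab i ⟨
        δ (A ⊗ₘ B , ab) i      ≈⟨ δab≈δb i ⟩
        δ b i                  ∎

  _-∂_ : ∀ {n} {G : Mat n → Set (c ⊔ ℓ)} → (Elt G → Vect n) → Vect n → Elt G → Vect n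
  (δ -∂ v) g = δ g -ᵥ ∂ v (proj₁ g)

  module _ {n} {G : Mat n → Set (c ⊔ ℓ)} where

    -∂-isCocycle : ∀ {δ} → IsCocycle G δ → ∀ v → IsCocycle G (δ -∂ v)
    -∂-isCocycle cδ v = cocycle-sub G cδ (∂-isCocycle G v)

    -∂-vanishes : ∀ {δ : Elt G → Vect n} {v a} → δ a ≈ᵥ ∂ v (proj₁ a) → (δ -∂ v) a ≈ᵥ 0ᵥ
    -∂-vanishes e i = x≈y⇒x∙y⁻¹≈ε (e i)

    -∂-coboundary : ∀ δ v → IsCoboundary G (δ -∂ v) → IsCoboundary G δ
    -∂-coboundary δ v (u , δ-∂v≈∂u) = u +ᵥ v , λ (g , g∈G) i → begin
      δ (g , g∈G) i                          ≈⟨ //-rightDividesˡ (∂ v g i) (δ (g , g∈G) i) ⟨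
      (δ (g , g∈G) i - ∂ v g i) + ∂ v g i    ≈⟨ +-congʳ (δ-∂v≈∂u (g , g∈G) i) ⟩
      ∂ u g i + ∂ v g i                      ≈⟨ ∂-+ u v g i ⟨
      ∂ (u +ᵥ v) g i                         ∎

  -- A block embedding φ : GL_m → GL_N: the coordinates of F^N form k
  -- blocks of size m (coordinate i of block j sits at pos i j), and φ a
  -- acts on every block as a.  Both factor embeddings of a Kronecker
  -- product are of this kind.
  record BlockEmbedding (m k N : ℕ) : Set (c ⊔ ℓ) where
    field
      pos       : Fin m → Fin k → Fin N
      unpos     : Fin N → Fin m × Fin k
      pos-unpos : ∀ a → uncurry pos (unpos a) ≡ a
      unpos-pos : ∀ i j → unpos (pos i j) ≡ (i , j)
      φ         : Mat m → Mat N
      φ-cong    : ∀ {a b} → a ≈ₘ b → φ a ≈ₘ φ b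
      φ-mul     : ∀ a b → (φ a ⊗ₘ φ b) ≈ₘ φ (a ⊗ₘ b)
      φ-act     : ∀ a x i j → (φ a ⊙ x) (pos i j) ≈ (a ⊙ (λ i' → x (pos i' j))) i

    block : Vect N → Fin k → Vect m
    block x j i = x (pos i j)

    glue : (Fin k → Vect m) → Vect N
    glue vs a = vs (proj₂ (unpos a)) (proj₁ (unpos a))

    block-glue : ∀ vs j → block (glue vs) j ≈ᵥ vs j
    block-glue vs j i = reflexive (P.cong (λ ij → vs (proj₂ ij) (proj₁ ij)) (unpos-pos i j))

  -- Restricting a G-cocycle along a block embedding of a group H with
  -- H¹(H, F^m) = 0 gives a coboundary: each block is an H-cocycle, hence a
  -- coboundary, and the solutions glue.
  module BlockRestriction {m k N} (B : BlockEmbedding m k N)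
           (H : Mat m → Set (c ⊔ ℓ)) (G : Mat N → Set (c ⊔ ℓ))
           (G-resp : ∀ {A A'} → A ≈ₘ A' → G A → G A')
           (φ∈ : ∀ {a} → H a → G (BlockEmbedding.φ B a)) where
    open BlockEmbedding B

    φ∈-mul : ∀ {a b} → H (a ⊗ₘ b) → G (φ a ⊗ₘ φ b)
    φ∈-mul {a} {b} ab = G-resp (≈ₘ-sym (φ-mul a b)) (φ∈ ab)

    blockCocycle : ∀ {δ} → IsCocycle G δ → ∀ j →
                   IsCocycle H (λ h → block (δ (φ (proj₁ h) , φ∈ (proj₂ h))) j)
    blockCocycle {δ} cδ j = record
      { δ-resp = λ { (a , p) (b , q) e i → δ-resp (φ a , φ∈ p) (φ b , φ∈ q) (φ-cong e) (pos i j) }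
      ; δ-mul  = λ { (a , p) (b , q) ab i → begin
          δ (φ (a ⊗ₘ b) , φ∈ ab) (pos i j)
            ≈⟨ δ-resp _ (φ a ⊗ₘ φ b , φ∈-mul ab) (≈ₘ-sym (φ-mul a b)) (pos i j) ⟩
          δ (φ a ⊗ₘ φ b , φ∈-mul ab) (pos i j)
            ≈⟨ δ-mul (φ a , φ∈ p) (φ b , φ∈ q) (φ∈-mul ab) (pos i j) ⟩
          δ (φ a , φ∈ p) (pos i j) + (φ a ⊙ δ (φ b , φ∈ q)) (pos i j)
            ≈⟨ +-congˡ (φ-act a (δ (φ b , φ∈ q)) i j) ⟩
          δ (φ a , φ∈ p) (pos i j) + (a ⊙ block (δ (φ b , φ∈ q)) j) i ∎ }
      }
      where open IsCocycle cδ

    restriction-coboundary : H¹-vanishes H → ∀ δ → IsCocycle G δ →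
                             ∃[ v ] (∀ a (p : H a) → δ (φ a , φ∈ p) ≈ᵥ ∂ v (φ a))
    restriction-coboundary H¹≡0 δ cδ = glue vs , λ a p →
      agree-on-cover pos unpos pos-unpos λ i j → begin
        δ (φ a , φ∈ p) (pos i j)               ≈⟨ vs-∂ j (a , p) i ⟩
        (a ⊙ vs j) i - vs j i                  ≈⟨ sub-cong (⊙-cong {A = a} ≈ₘ-refl (block-glue vs j) i)
                                                           (block-glue vs j i) ⟨
        (a ⊙ block (glue vs) j) i - glue vs (pos i j) ≈⟨ sub-cong (φ-act a (glue vs) i j) refl ⟨
        ∂ (glue vs) (φ a) (pos i j)            ∎
      where
      solution : ∀ j → IsCoboundary H (λ h → block (δ (φ (proj₁ h) , φ∈ (proj₂ h))) j)
      solution j = H¹≡0 _ (blockCocycle cδ j)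
      vs : Fin k → Vect m
      vs j = proj₁ (solution j)
      vs-∂ : ∀ j (h : Elt H) → block (δ (φ (proj₁ h) , φ∈ (proj₂ h))) j ≈ᵥ ∂ (vs j) (proj₁ h)
      vs-∂ j = proj₂ (solution j)

  Fixed : ∀ {n} {I : Set (c ⊔ ℓ)} → (I → Mat n) → Vect n → Set (c ⊔ ℓ)
  Fixed N x = ∀ i → (N i ⊙ x) ≈ᵥ x

  module _ {n} {I : Set (c ⊔ ℓ)} (N : I → Mat n) where

    fixed-resp : ∀ {u v} → u ≈ᵥ v → Fixed N u → Fixed N v
    fixed-resp e fu i = ≈ᵥ-trans (⊙-cong ≈ₘ-refl (≈ᵥ-sym e)) (≈ᵥ-trans (fu i) e)

    fixed-0 : Fixed N 0ᵥ
    fixed-0 i = ⊙-0 (N i)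

    fixed-+ : ∀ {u v} → Fixed N u → Fixed N v → Fixed N (u +ᵥ v)
    fixed-+ {u} {v} fu fv i = ≈ᵥ-trans (⊙-+ (N i) u v) (λ j → +-cong (fu i j) (fv i j))

    fixed-scale : ∀ a {v} → Fixed N v → Fixed N (a ·ᵥ v)
    fixed-scale a {v} fv i = ≈ᵥ-trans (⊙-scale (N i) a v) (λ j → *-congˡ (fv i j))

    fixed-sumV : ∀ {k} (ws : Fin k → Vect n) → (∀ m → Fixed N (ws m)) → Fixed N (sumV ws)
    fixed-sumV ws f i = ≈ᵥ-trans (⊙-sumV (N i) ws) (sumV-cong (λ m → f m i))

    normalising⇒fixed-invariant : ∀ {g} → (∀ i → ∃[ i' ] ((N i ⊗ₘ g) ≈ₘ (g ⊗ₘ N i'))) →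
                                  ∀ {x} → Fixed N x → Fixed N (g ⊙ x)
    normalising⇒fixed-invariant {g} normalises {x} fx i j = begin
      (N i ⊙ (g ⊙ x)) j     ≈⟨ ⊙-assoc (N i) g x j ⟨
      ((N i ⊗ₘ g) ⊙ x) j    ≈⟨ ⊙-cong (proj₂ (normalises i)) ≈ᵥ-refl j ⟩
      ((g ⊗ₘ N i') ⊙ x) j   ≈⟨ ⊙-assoc g (N i') x j ⟩
      (g ⊙ (N i' ⊙ x)) j    ≈⟨ ⊙-cong {A = g} ≈ₘ-refl (fx i') j ⟩
      (g ⊙ x) j             ∎
      where i' = proj₁ (normalises i)

  -- For a semisimple G, the projections π m onto the summands W m of the
  -- decomposition F^n = ⊕ W m are well defined, linear and G-equivariant,
  -- all by uniqueness of the decomposition.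
  module Components {n} (G : Mat n → Set (c ⊔ ℓ)) (ss : Semisimple G) where
    k : ℕ
    k = proj₁ ss

    W : Fin k → Vect n → Set (c ⊔ ℓ)
    W = proj₁ (proj₂ ss)

    irreducible : ∀ m → IsIrreducible G (W m)
    irreducible = proj₁ (proj₂ (proj₂ ss))

    decompose : ∀ x → ∃[ ws ] ((∀ m → W m (ws m)) × x ≈ᵥ sumV ws)
    decompose = proj₁ (proj₂ (proj₂ (proj₂ ss)))

    independent : ∀ ws → (∀ m → W m (ws m)) → sumV ws ≈ᵥ 0ᵥ → ∀ m → ws m ≈ᵥ 0ᵥ
    independent = proj₂ (proj₂ (proj₂ (proj₂ ss)))

    submodule : ∀ m → IsGSubmodule G (W m)
    submodule m = IsIrreducible.submodule (irreducible m)

    W-sub : ∀ m {x y} → W m x → W m y → W m (x -ᵥ y)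
    W-sub m {x} {y} wx wy = resp (λ i → +-congˡ (-1*x≈-x (y i))) (add wx (scale (- 1#) wy))
      where open IsSubspace (IsGSubmodule.subspace (submodule m))

    π : Fin k → Vect n → Vect n
    π m x = proj₁ (decompose x) m

    π-in : ∀ m x → W m (π m x)
    π-in m x = proj₁ (proj₂ (decompose x)) m

    π-sum : ∀ x → x ≈ᵥ sumV (λ m → π m x)
    π-sum x = proj₂ (proj₂ (decompose x))

    π-unique : ∀ x ws → (∀ m → W m (ws m)) → x ≈ᵥ sumV ws → ∀ m → π m x ≈ᵥ ws m
    π-unique x ws ws∈W x≈Σws m i =
      x∙y⁻¹≈ε⇒x≈y _ _ (independent difference (λ m → W-sub m (π-in m x) (ws∈W m)) Σdifference≈0 m i)
      where
      difference : Fin k → Vect n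
      difference m = π m x -ᵥ ws m
      Σdifference≈0 : sumV difference ≈ᵥ 0ᵥ
      Σdifference≈0 j = trans (sumF-- (λ m → π m x j) (λ m → ws m j))
                              (x≈y⇒x∙y⁻¹≈ε (trans (sym (π-sum x j)) (x≈Σws j)))

    π-cong : ∀ m {x y} → x ≈ᵥ y → π m x ≈ᵥ π m y
    π-cong m {x} {y} e = π-unique x (λ m → π m y) (λ m → π-in m y) (≈ᵥ-trans e (π-sum y)) m

    π-sub : ∀ m x y → π m (x -ᵥ y) ≈ᵥ (π m x -ᵥ π m y)
    π-sub m x y = π-unique (x -ᵥ y) (λ m → π m x -ᵥ π m y) (λ m → W-sub m (π-in m x) (π-in m y))
      (λ j → trans (sub-cong (π-sum x j) (π-sum y j)) (sym (sumF-- (λ m → π m x j) (λ m → π m y j)))) m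

    π-equiv : ∀ m {g} → G g → ∀ x → π m (g ⊙ x) ≈ᵥ (g ⊙ π m x)
    π-equiv m {g} g∈G x = π-unique (g ⊙ x) (λ m → g ⊙ π m x)
      (λ m → IsGSubmodule.invariant (submodule m) g∈G (π-in m x))
      (≈ᵥ-trans (⊙-cong ≈ₘ-refl (π-sum x)) (⊙-sumV g (λ m → π m x))) m

  -- If G is semisimple and the fixed space V^N of a family N is
  -- G-invariant, then there is a G-equivariant linear projection Pr of F^n
  -- onto V^N: each W m meets V^N in a G-submodule, hence by
  -- irreducibility W m ⊆ V^N or W m ∩ V^N = 0, and Pr keeps exactly the
  -- components of the first kind.
  module FixedProjection {n} (G : Mat n → Set (c ⊔ ℓ)) (ss : Semisimple G)
           {I : Set (c ⊔ ℓ)} (N : I → Mat n) (N∈G : ∀ i → G (N i))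
           (fixed-invariant : ∀ {g} → G g → ∀ {x} → Fixed N x → Fixed N (g ⊙ x)) where
    open Components G ss

    fixedPart : Fin k → Vect n → Set (c ⊔ ℓ)
    fixedPart m x = W m x × Fixed N x

    fixedPart-submodule : ∀ m → IsGSubmodule G (fixedPart m)
    fixedPart-submodule m = record
      { subspace = record
        { resp  = λ e (wu , fu) → resp e wu , fixed-resp N e fu
        ; zero∈ = zero∈ , fixed-0 N
        ; add   = λ (wu , fu) (wv , fv) → add wu wv , fixed-+ N fu fv
        ; scale = λ a (wv , fv) → scale a wv , fixed-scale N a fv
        }
      ; invariant = λ g∈G (wv , fv) → IsGSubmodule.invariant (submodule m) g∈G wv , fixed-invariant g∈G fv
      }
      where open IsSubspace (IsGSubmodule.subspace (submodule m))

    Alternative : Fin k → Set (c ⊔ ℓ)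
    Alternative m = (∀ {v} → fixedPart m v → v ≈ᵥ 0ᵥ) ⊎ (∀ {v} → W m v → fixedPart m v)

    alternative : ∀ m → Alternative m
    alternative m = IsIrreducible.minimal (irreducible m) (fixedPart m) (fixedPart-submodule m) proj₁

    keep : ∀ {m} → Alternative m → Vect n → Vect n
    keep (inj₁ _) x = 0ᵥ
    keep (inj₂ _) x = x

    keep-cong : ∀ {m} (s : Alternative m) {x y} → x ≈ᵥ y → keep s x ≈ᵥ keep s y
    keep-cong (inj₁ _) e = ≈ᵥ-refl
    keep-cong (inj₂ _) e = e

    keep-sub : ∀ {m} (s : Alternative m) x y → keep s (x -ᵥ y) ≈ᵥ (keep s x -ᵥ keep s y)
    keep-sub (inj₁ _) x y i = sym (-‿inverseʳ 0#)
    keep-sub (inj₂ _) x y   = ≈ᵥ-refl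

    keep-⊙ : ∀ {m} (s : Alternative m) g x → keep s (g ⊙ x) ≈ᵥ (g ⊙ keep s x)
    keep-⊙ (inj₁ _) g x = ≈ᵥ-sym (⊙-0 g)
    keep-⊙ (inj₂ _) g x = ≈ᵥ-refl

    keep-fixed : ∀ {m} (s : Alternative m) {x} → W m x → Fixed N (keep s x)
    keep-fixed (inj₁ _)        _  = fixed-0 N
    keep-fixed (inj₂ W⊆fixed) wx = proj₂ (W⊆fixed wx)

    keep-id : ∀ {m} (s : Alternative m) {x} → W m x → Fixed N x → keep s x ≈ᵥ x
    keep-id (inj₁ fixed≈0) wx fx = ≈ᵥ-sym (fixed≈0 (wx , fx))
    keep-id (inj₂ _)       wx fx = ≈ᵥ-refl

    Pr : Vect n → Vect n
    Pr x = sumV (λ m → keep (alternative m) (π m x))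

    Pr-cong : ∀ {x y} → x ≈ᵥ y → Pr x ≈ᵥ Pr y
    Pr-cong e = sumV-cong (λ m → keep-cong (alternative m) (π-cong m e))

    Pr-fixed : ∀ x → Fixed N (Pr x)
    Pr-fixed x = fixed-sumV N _ (λ m → keep-fixed (alternative m) (π-in m x))

    Pr-id : ∀ x → Fixed N x → Pr x ≈ᵥ x
    Pr-id x fx = ≈ᵥ-trans (sumV-cong (λ m → keep-id (alternative m) (π-in m x) (π-fixed m)))
                          (≈ᵥ-sym (π-sum x))
      where
      π-fixed : ∀ m → Fixed N (π m x)
      π-fixed m i = ≈ᵥ-trans (≈ᵥ-sym (π-equiv m (N∈G i) x)) (π-cong m (fx i))

    Pr-sub : ∀ x y → Pr (x -ᵥ y) ≈ᵥ (Pr x -ᵥ Pr y)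
    Pr-sub x y = ≈ᵥ-trans
      (sumV-cong (λ m → ≈ᵥ-trans (keep-cong (alternative m) (π-sub m x y)) (keep-sub (alternative m) _ _)))
      (λ j → sumF-- (λ m → keep (alternative m) (π m x) j) (λ m → keep (alternative m) (π m y) j))

    Pr-equiv : ∀ {g} → G g → ∀ x → Pr (g ⊙ x) ≈ᵥ (g ⊙ Pr x)
    Pr-equiv {g} g∈G x = ≈ᵥ-trans
      (sumV-cong (λ m → ≈ᵥ-trans (keep-cong (alternative m) (π-equiv m g∈G x)) (keep-⊙ (alternative m) g _)))
      (≈ᵥ-sym (⊙-sumV g (λ m → keep (alternative m) (π m x))))

    Pr-∂ : ∀ {g} → G g → ∀ w → Pr (∂ w g) ≈ᵥ ∂ (Pr w) g
    Pr-∂ g∈G w = ≈ᵥ-trans (Pr-sub _ w) (λ j → sub-cong (Pr-equiv g∈G w j) refl)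

  module CentralProductFacts (t r : ℕ) (Gt : Mat t → Set (c ⊔ ℓ)) (Gr : Mat r → Set (c ⊔ ℓ))
           (sGt : IsSubgroupGL Gt) (sGr : IsSubgroupGL Gr) where
    open Kronecker t r

    G : Mat (t *ℕ r) → Set (c ⊔ ℓ)
    G = CentralProduct Gt Gr

    G-resp : ∀ {A A'} → A ≈ₘ A' → G A → G A'
    G-resp e (σ , τ , p , q , A≈σ⊗τ) = σ , τ , p , q , ≈ₘ-trans (≈ₘ-sym e) A≈σ⊗τ

    left∈ : ∀ {σ} → Gt σ → G (σ ⊗1)
    left∈ p = _ , idM , p , IsSubgroupGL.has-id sGr , ≈ₘ-refl

    right∈ : ∀ {τ} → Gr τ → G (1⊗ τ)
    right∈ q = idM , _ , IsSubgroupGL.has-id sGt , q , ≈ₘ-refl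

    left-right-commute : ∀ σ τ → ((σ ⊗1) ⊗ₘ (1⊗ τ)) ≈ₘ ((1⊗ τ) ⊗ₘ (σ ⊗1))
    left-right-commute σ τ = ≈ₘ-trans (kron-factorˡ σ τ) (≈ₘ-sym (kron-factorʳ σ τ))

    left-right∈ : ∀ {σ τ} → Gt σ → Gr τ → G ((σ ⊗1) ⊗ₘ (1⊗ τ))
    left-right∈ {σ} {τ} p q = σ , τ , p , q , kron-factorˡ σ τ

    right-left∈ : ∀ {σ τ} → Gt σ → Gr τ → G ((1⊗ τ) ⊗ₘ (σ ⊗1))
    right-left∈ {σ} {τ} p q = σ , τ , p , q , kron-factorʳ σ τ

    leftEmbedding : BlockEmbedding t r (t *ℕ r)
    leftEmbedding = record
      { pos       = combine
      ; unpos     = remQuot {t} r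
      ; pos-unpos = combine-remQuot {t} r
      ; unpos-pos = remQuot-combine
      ; φ         = _⊗1
      ; φ-cong    = λ e → kron-cong e (≈ₘ-refl {A = idM})
      ; φ-mul     = λ σ σ' → ≈ₘ-trans (kron-mul σ σ' idM idM) (kron-cong (≈ₘ-refl {A = σ ⊗ₘ σ'}) (idM-⊗ₘ idM))
      ; φ-act     = kron-left-act
      }

    rightEmbedding : BlockEmbedding r t (t *ℕ r)
    rightEmbedding = record
      { pos       = λ j i → combine i j
      ; unpos     = λ a → Product.swap (remQuot {t} r a)
      ; pos-unpos = combine-remQuot {t} r
      ; unpos-pos = λ j i → P.cong Product.swap (remQuot-combine i j)
      ; φ         = 1⊗_
      ; φ-cong    = kron-cong (≈ₘ-refl {A = idM})
      ; φ-mul     = λ τ τ' → ≈ₘ-trans (kron-mul idM idM τ τ') (kron-cong (idM-⊗ₘ idM) (≈ₘ-refl {A = τ ⊗ₘ τ'}))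
      ; φ-act     = λ τ x j i → kron-right-act τ x i j
      }

    Left : Elt Gt → Mat (t *ℕ r)
    Left (σ , _) = σ ⊗1

    -- G_t ⊗ 1 is normal in G: for g = σ' ⊗ τ',
    -- (σ ⊗ 1) g = σσ' ⊗ τ' = σ'σ'' ⊗ τ' = g (σ'' ⊗ 1)  with σ'' = σ'⁻¹ σ σ'
    left-normal : ∀ {g} → G g → ∀ i → ∃[ i' ] ((Left i ⊗ₘ g) ≈ₘ (g ⊗ₘ Left i'))
    left-normal {g} (σ' , τ' , p' , q' , g≈σ'⊗τ') (σ , p) = (σ'' , p'') ,
      ≈ₘ-trans (⊗ₘ-cong ≈ₘ-refl g≈σ'⊗τ')
      (≈ₘ-trans (kron-mul σ σ' idM τ')
      (≈ₘ-trans (kron-cong (≈ₘ-sym σ'σ''≈σσ') (≈ₘ-trans (idM-⊗ₘ τ') (≈ₘ-sym (⊗ₘ-idM τ'))))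
      (≈ₘ-trans (≈ₘ-sym (kron-mul σ' σ'' τ' idM))
                (⊗ₘ-cong (≈ₘ-sym g≈σ'⊗τ') ≈ₘ-refl))))
      where
      open IsSubgroupGL sGt
      σ'⁻¹ : Mat t
      σ'⁻¹ = proj₁ (invble p')
      σ'σ'⁻¹≈1 : (σ' ⊗ₘ σ'⁻¹) ≈ₘ idM
      σ'σ'⁻¹≈1 = proj₁ (proj₂ (invble p'))
      σ'' : Mat t
      σ'' = (σ'⁻¹ ⊗ₘ σ) ⊗ₘ σ'
      p'' : Gt σ''
      p'' = mul (mul (inv p' σ'σ'⁻¹≈1) p) p'
      σ'σ''≈σσ' : (σ' ⊗ₘ σ'') ≈ₘ (σ ⊗ₘ σ')
      σ'σ''≈σσ' = ≈ₘ-trans (≈ₘ-sym (⊗ₘ-assoc σ' (σ'⁻¹ ⊗ₘ σ) σ'))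
                    (⊗ₘ-cong (≈ₘ-trans (≈ₘ-sym (⊗ₘ-assoc σ' σ'⁻¹ σ))
                               (≈ₘ-trans (⊗ₘ-cong σ'σ'⁻¹≈1 ≈ₘ-refl) (idM-⊗ₘ σ)))
                             ≈ₘ-refl)

    left-fixed-invariant : ∀ {g} → G g → ∀ {x} → Fixed Left x → Fixed Left (g ⊙ x)
    left-fixed-invariant g∈G = normalising⇒fixed-invariant Left (left-normal g∈G)

    ∂-left-fixed : ∀ {u} → Fixed Left u → ∀ {M σ τ} → Gt σ → M ≈ₘ kron σ τ → ∂ u M ≈ᵥ ∂ u (1⊗ τ)
    ∂-left-fixed {u} fu {M} {σ} {τ} p M≈σ⊗τ i = sub-cong (begin
      (M ⊙ u) i                       ≈⟨ ⊙-cong (≈ₘ-trans M≈σ⊗τ (≈ₘ-sym (kron-factorʳ σ τ))) ≈ᵥ-refl i ⟩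
      (((1⊗ τ) ⊗ₘ (σ ⊗1)) ⊙ u) i      ≈⟨ ⊙-assoc (1⊗ τ) (σ ⊗1) u i ⟩
      ((1⊗ τ) ⊙ ((σ ⊗1) ⊙ u)) i       ≈⟨ ⊙-cong {A = 1⊗ τ} ≈ₘ-refl (fu (σ , p)) i ⟩
      ((1⊗ τ) ⊙ u) i                  ∎) refl

    -- If H¹(G_r, F^r) = 0 and G acts semisimply, every G-cocycle δ vanishing
    -- on G_t ⊗ 1 is a coboundary.  Indeed δ(σ ⊗ τ) = δ(1 ⊗ τ), and these
    -- values are fixed by G_t ⊗ 1; on 1 ⊗ G_r we have δ = ∂w, and the
    -- projection Pr w of w onto the G_t ⊗ 1-fixed vectors satisfies δ = ∂(Pr w)
    -- on all of G.
    left-trivial⇒coboundary : Semisimple G → H¹-vanishes Gr → ∀ δ → IsCocycle G δ →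
      (∀ σ (p : Gt σ) → δ (σ ⊗1 , left∈ p) ≈ᵥ 0ᵥ) → IsCoboundary G δ
    left-trivial⇒coboundary ss H¹Gr≡0 δ cδ vanishes = Pr w , δ≈∂Prw
      where
      open IsCocycle cδ
      open FixedProjection G ss Left (λ i → left∈ (proj₂ i)) left-fixed-invariant
      open BlockRestriction rightEmbedding Gr G G-resp right∈ using (restriction-coboundary)

      δʳ : ∀ {τ} → Gr τ → Vect (t *ℕ r)
      δʳ {τ} q = δ (1⊗ τ , right∈ q)

      commuting : ∀ {σ τ} (p : Gt σ) (q : Gr τ) →
        δ ((σ ⊗1) ⊗ₘ (1⊗ τ) , left-right∈ p q) ≈ᵥ δʳ q × ((σ ⊗1) ⊙ δʳ q) ≈ᵥ δʳ q
      commuting {σ} {τ} p q = vanishing-commuting G cδ (σ ⊗1 , left∈ p) (1⊗ τ , right∈ q)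
        (vanishes σ p) (left-right∈ p q) (right-left∈ p q) (left-right-commute σ τ)

      δʳ-fixed : ∀ {τ} (q : Gr τ) → Fixed Left (δʳ q)
      δʳ-fixed q (σ , p) = proj₂ (commuting p q)

      right-solution : ∃[ w ] (∀ τ (q : Gr τ) → δʳ q ≈ᵥ ∂ w (1⊗ τ))
      right-solution = restriction-coboundary H¹Gr≡0 δ cδ

      w : Vect (t *ℕ r)
      w = proj₁ right-solution

      δ≈∂Prw : ∀ g → δ g ≈ᵥ ∂ (Pr w) (proj₁ g)
      δ≈∂Prw g@(M , σ , τ , p , q , M≈σ⊗τ) i = begin
        δ g i                        ≈⟨ δ-resp g (_ , left-right∈ p q)
                                                 (≈ₘ-trans M≈σ⊗τ (≈ₘ-sym (kron-factorˡ σ τ))) i ⟩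
        δ (_ , left-right∈ p q) i    ≈⟨ proj₁ (commuting p q) i ⟩
        δʳ q i                       ≈⟨ Pr-id (δʳ q) (δʳ-fixed q) i ⟨
        Pr (δʳ q) i                  ≈⟨ Pr-cong (proj₂ right-solution τ q) i ⟩
        Pr (∂ w (1⊗ τ)) i            ≈⟨ Pr-∂ (right∈ q) w i ⟩
        ∂ (Pr w) (1⊗ τ) i            ≈⟨ ∂-left-fixed (Pr-fixed w) {τ = τ} p M≈σ⊗τ i ⟨
        ∂ (Pr w) M i                 ∎

lemma3p9 : ∀ {c ℓ} (F : Field c ℓ) (p m : ℕ) → IsFiniteFieldOfOrder F p m →
    (t r : ℕ) → let open LinAlg F in
    (Gt : Mat t → Set (c ⊔ ℓ)) (Gr : Mat r → Set (c ⊔ ℓ)) →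
    IsSubgroupGL Gt → IsSubgroupGL Gr →
    Semisimple (CentralProduct Gt Gr) →
    H¹-vanishes Gt → H¹-vanishes Gr →
    H¹-vanishes (CentralProduct Gt Gr)
-- After the correction by the coboundary ∂v that agrees with δ on G_t ⊗ 1,
-- the cocycle δ - ∂v vanishes on G_t ⊗ 1 and so is a coboundary; hence so
-- is δ.
lemma3p9 F _ _ _ t r Gt Gr sGt sGr ss H¹Gt≡0 H¹Gr≡0 δ cδ =
  -∂-coboundary δ v (left-trivial⇒coboundary ss H¹Gr≡0 (δ -∂ v) (-∂-isCocycle cδ v)
                                              (λ σ p → -∂-vanishes {δ = δ} (δ≈∂v σ p)))
  where
  open Tensor F
  open CentralProductFacts t r Gt Gr sGt sGr
  open BlockRestriction leftEmbedding Gt G G-resp left∈ using (restriction-coboundary)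
  open LinAlg F using (Vect; _≈ᵥ_)
  open Kronecker t r using (_⊗1)

  left-solution : ∃[ v ] (∀ σ (p : Gt σ) → δ (σ ⊗1 , left∈ p) ≈ᵥ ∂ v (σ ⊗1))
  left-solution = restriction-coboundary H¹Gt≡0 δ cδ

  v : Vect (t *ℕ r)
  v = proj₁ left-solution

  δ≈∂v : ∀ σ (p : Gt σ) → δ (σ ⊗1 , left∈ p) ≈ᵥ ∂ v (σ ⊗1)
  δ≈∂v = proj₂ left-solution
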